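{- If $g$ is an invertible graph game board, then $g\oplus g\sim\langle\ \rangle$ (i.e. $[g]+[g]=\mathbf 0$).
   Context: A graph game board is a pair $g=(G,A)$ where $G$ is a finite simple graph whose vertices carry real weights $\mathrm{wt}(v)$ and $A$ is a set of vertices (available). A component is unbroached if it contains no vertex of $A$. $g\backslash v$: delete $v$ and its edges and replace $A$ by $(A\cup\{$neighbours of $v\})\backslash\{v\}$. Legal initial moves: vertices of $A$ and all vertices of unbroached components. Players alternately choose legal moves (Player One first) until no vertices remain; Player One's outcome is the weight he took minus the weight taken by Player Two; $\mathrm{val}(g)$ is this under optimal play. $\oplus$ is disjoint union with united available sets; $\langle\ \rangle$ is the empty board. $g_1\sim g_2$ means $\mathrm{val}(g_1\oplus h)=\mathrm{val}(g_2\oplus h)$ for all boards $h$. $g$ is invertible if there is a board $h$ with $g\oplus h\sim\langle\ \rangle$.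
   Formalization: The vertex weights of g, of its inverse board and of every test board h in ∼ are rational rather than real. -}

module Defs where

open import Data.Nat using (ℕ; zero; suc; _+_)
open import Data.Fin using (Fin; splitAt; punchIn; _≟_)
open import Data.Fin.Properties using (punchIn-injective)
open import Data.Bool using (Bool; true; false; _∧_; _∨_; not)
open import Data.List using (List; []; _∷_; map; filter; foldr)
open import Data.Bool.ListAction using (any)
open import Data.Bool.Properties using (T?)
open import Data.List.Base using (allFin)
open import Data.Sum using (_⊎_; inj₁; inj₂; [_,_])
open import Data.Product using (Σ; _,_)
open import Data.Rational using (ℚ; 0ℚ; _-_; _⊔_)
open import Relation.Nullary.Decidable using (⌊_⌋)
open import Relation.Binary.PropositionalEquality using (_≡_; refl)

record Board (n : ℕ) : Set where
  field
    adj     : Fin n → Fin n → Bool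
    adj-sym : ∀ u v → adj u v ≡ adj v u
    adj-irr : ∀ v → adj v v ≡ false
    wt      : Fin n → ℚ
    avail   : Fin n → Bool
open Board public

empty : Board 0
empty = record { adj = λ () ; adj-sym = λ () ; adj-irr = λ () ; wt = λ () ; avail = λ () }

module _ {m n : ℕ} (g₁ : Board m) (g₂ : Board n) where
  private
    A : Fin (m + n) → Fin (m + n) → Bool
    A i j with splitAt m i | splitAt m j
    ... | inj₁ a | inj₁ b = adj g₁ a b
    ... | inj₂ a | inj₂ b = adj g₂ a b
    ... | inj₁ _ | inj₂ _ = false
    ... | inj₂ _ | inj₁ _ = false

    A-sym : ∀ i j → A i j ≡ A j i
    A-sym i j with splitAt m i | splitAt m j
    ... | inj₁ a | inj₁ b = adj-sym g₁ a b
    ... | inj₂ a | inj₂ b = adj-sym g₂ a b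
    ... | inj₁ _ | inj₂ _ = refl
    ... | inj₂ _ | inj₁ _ = refl

    A-irr : ∀ i → A i i ≡ false
    A-irr i with splitAt m i
    ... | inj₁ a = adj-irr g₁ a
    ... | inj₂ a = adj-irr g₂ a

  infixl 6 _⊕_
  _⊕_ : Board (m + n)
  _⊕_ = record
    { adj = A ; adj-sym = A-sym ; adj-irr = A-irr
    ; wt = λ i → [ wt g₁ , wt g₂ ] (splitAt m i)
    ; avail = λ i → [ avail g₁ , avail g₂ ] (splitAt m i) }

delete : {m : ℕ} → Board (suc m) → Fin (suc m) → Board m
delete g v = record
  { adj = λ i j → adj g (punchIn v i) (punchIn v j)
  ; adj-sym = λ i j → adj-sym g (punchIn v i) (punchIn v j)
  ; adj-irr = λ i → adj-irr g (punchIn v i)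
  ; wt = λ i → wt g (punchIn v i)
  ; avail = λ i → avail g (punchIn v i) ∨ adj g v (punchIn v i) }

anyFin : {n : ℕ} → (Fin n → Bool) → Bool
anyFin {n} p = any p (allFin n)

reach : {n : ℕ} → Board n → ℕ → Fin n → Fin n → Bool
reach g zero    u w = ⌊ u ≟ w ⌋
reach g (suc k) u w = reach g k u w ∨ anyFin (λ x → reach g k u x ∧ adj g x w)

unbroached : {n : ℕ} → Board n → Fin n → Bool
unbroached {n} g v = not (anyFin (λ w → reach g n v w ∧ avail g w))

legal : {n : ℕ} → Board n → Fin n → Bool
legal g v = avail g v ∨ unbroached g v

-- maximum of a list (the default 0ℚ for [] is never used, since a
-- nonempty board always has a legal move)
maxL : List ℚ → ℚ
maxL []       = 0ℚ
maxL (x ∷ xs) = foldr _⊔_ x xs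

-- value for the player to move under optimal play (negamax form of
-- "weight taken by the mover minus weight taken by the opponent")
val : {n : ℕ} → Board n → ℚ
val {zero}  g = 0ℚ
val {suc m} g =
  maxL (map (λ v → wt g v - val (delete g v)) (filter (λ v → T? (legal g v)) (allFin (suc m))))

infix 4 _∼_
_∼_ : {m n : ℕ} → Board m → Board n → Set
g₁ ∼ g₂ = ∀ (k : ℕ) (h : Board k) → val (g₁ ⊕ h) ≡ val (g₂ ⊕ h)

Invertible : {n : ℕ} → Board n → Set
Invertible g = Σ ℕ λ k → Σ (Board k) λ h → (g ⊕ h) ∼ empty

-- If x and x' are isomorphic boards, a player in x ⊕ x' can answer every move in one
-- copy by the corresponding move in the other. Played beside a board k this gives
-- val ((x ⊕ x') ⊕ k) ≤ val k when k has an even number of vertices and the reverse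
-- inequality when the number is odd: the two cases alternate with each move in k, and
-- an odd k is never empty, so whoever has to move in k can.
--
-- If g ⊕ h ∼ ⟨ ⟩, then for every board c,
--   val c = val ((g ⊕ h) ⊕ ((g ⊕ h) ⊕ c)) = val ((h ⊕ h) ⊕ ((g ⊕ g) ⊕ c)).
-- The mirror bound for g ⊕ g beside c and for h ⊕ h beside (g ⊕ g) ⊕ c, which has the
-- parity of c, then bounds val ((g ⊕ g) ⊕ c) by val c from both sides.
--
-- Underneath, val is invariant under relabelling vertices; this is what makes ⊕
-- commutative and associative and lets a move in one summand be computed there.

module Submission where

open import Defs
open import Data.Bool using (Bool; true; false; _∧_; _∨_; not)
open import Data.Bool.Properties using (T-≡; T?; ∨-zeroʳ; ∨-identityʳ; ∧-zeroʳ; ¬-not; ⇔→≡)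
open import Data.Fin using (Fin; zero; suc; _≟_; punchIn; punchOut; splitAt; join; _↑ˡ_; _↑ʳ_)
open import Data.Fin.Properties
  using ( punchIn-injective; punchInᵢ≢i; punchIn-punchOut; ↑ˡ-injective; ↑ʳ-injective
        ; splitAt-↑ˡ; splitAt-↑ʳ; splitAt-join; splitAt⁻¹-↑ˡ; splitAt⁻¹-↑ʳ )
open import Data.Fin.Subset using (Subset; ∣_∣) renaming (_∈_ to _∈ₛ_; _⊆_ to _⊆ₛ_)
open import Data.Fin.Subset.Properties using (_∈?_; _⊂?_; p⊂q⇒∣p∣<∣q∣; ∣p∣≤n)
open import Data.List using (List; []; _∷_; map; filter; allFin)
open import Data.List.Membership.Propositional using (_∈_; lose)
open import Data.List.Membership.Propositional.Properties
  using (∈-allFin; ∈-filter⁺; ∈-filter⁻; ∈-map⁺; ∈-map⁻; foldr-selective)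
open import Data.List.Relation.Unary.Any using (here; there; satisfied)
open import Data.List.Relation.Unary.Any.Properties using (any⁺; any⁻)
open import Data.Nat using (ℕ; zero; suc; _+_; z≤n; _≤′_; ≤′-refl; ≤′-step)
import Data.Nat as ℕ
import Data.Nat.Properties as ℕ
open import Data.Product using (∃; _×_; _,_; proj₁; proj₂)
import Data.Product as Prod
open import Data.Rational using (ℚ; 0ℚ; _-_; _⊔_; _≤_)
open import Data.Rational.Properties
  using ( ≤-refl; ≤-reflexive; ≤-trans; ≤-antisym; p≤p⊔q; p≤q⊔p; ⊔-sel; +-monoʳ-≤; neg-antimono-≤
        ; module ≤-Reasoning )
open import Data.Rational.Solver using (module +-*-Solver)
open import Data.Sum using (_⊎_; inj₁; inj₂; [_,_]′; swap)
import Data.Sum as Sum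
open import Data.Vec using (tabulate)
open import Data.Vec.Properties using ([]=⇒lookup; lookup⇒[]=; lookup∘tabulate)
open import Function using (_∘_)
open import Function.Bundles using (Equivalence; mk⇔)
open import Relation.Binary.PropositionalEquality
  using (_≡_; _≢_; refl; sym; trans; cong; cong₂; subst; module ≡-Reasoning)
open import Relation.Nullary using (contradiction; yes; no)
open import Relation.Nullary.Decidable using (⌊_⌋; decidable-stable; toWitness)

private
  variable
    l m n o m' n' : ℕ

∨-trueˡ : ∀ {a b} → a ≡ true → a ∨ b ≡ true
∨-trueˡ refl = refl

∨-trueʳ : ∀ a {b} → b ≡ true → a ∨ b ≡ true
∨-trueʳ a refl = ∨-zeroʳ a

∨-true⁻ : ∀ a {b} → a ∨ b ≡ true → a ≡ true ⊎ b ≡ true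
∨-true⁻ true  _      = inj₁ refl
∨-true⁻ false b≡true = inj₂ b≡true

∧-true⁺ : ∀ {a b} → a ≡ true → b ≡ true → a ∧ b ≡ true
∧-true⁺ refl refl = refl

∧-true⁻ : ∀ a {b} → a ∧ b ≡ true → a ≡ true × b ≡ true
∧-true⁻ true b≡true = refl , b≡true

not-false⁻ : ∀ {a} → not a ≡ false → a ≡ true
not-false⁻ {true} _ = refl

anyFin⁻ : (p : Fin n → Bool) → anyFin p ≡ true → ∃ λ i → p i ≡ true
anyFin⁻ {n} p any≡true =
  Prod.map₂ (Equivalence.to T-≡) (satisfied (any⁻ p (allFin n) (Equivalence.from T-≡ any≡true)))

anyFin⁺ : (p : Fin n → Bool) {i : Fin n} → p i ≡ true → anyFin p ≡ true
anyFin⁺ p {i} pi≡true = Equivalence.to T-≡ (any⁺ p (lose (∈-allFin i) (Equivalence.from T-≡ pi≡true)))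

⌊≟⌋-∘-injective : (f : Fin m → Fin n) → (∀ {i j} → f i ≡ f j → i ≡ j) →
                  ∀ u w → ⌊ f u ≟ f w ⌋ ≡ ⌊ u ≟ w ⌋
⌊≟⌋-∘-injective f f-injective u w with u ≟ w | f u ≟ f w
... | yes _   | yes _     = refl
... | no _    | no _      = refl
... | yes u≡w | no fu≢fw  = contradiction (cong f u≡w) fu≢fw
... | no u≢w  | yes fu≡fw = contradiction (f-injective fu≡fw) u≢w

anyFin-reindex : (f : Fin m → Fin n) (f⁻¹ : Fin n → Fin m) → (∀ j → f (f⁻¹ j) ≡ j) →
                 (p : Fin m → Bool) (q : Fin n → Bool) → (∀ i → q (f i) ≡ p i) → anyFin q ≡ anyFin p
anyFin-reindex f f⁻¹ f∘f⁻¹ p q q∘f≗p = ⇔→≡ (mk⇔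
  (λ any-q → let j , qj = anyFin⁻ q any-q in
    anyFin⁺ p (trans (sym (q∘f≗p (f⁻¹ j))) (trans (cong q (f∘f⁻¹ j)) qj)))
  (λ any-p → let i , pi = anyFin⁻ p any-p in anyFin⁺ q (trans (q∘f≗p i) pi)))

anyFin-cong : {p q : Fin n → Bool} → (∀ i → p i ≡ q i) → anyFin p ≡ anyFin q
anyFin-cong p≗q = anyFin-reindex (λ i → i) (λ i → i) (λ _ → refl) _ _ p≗q

anyFin-false : (p : Fin n → Bool) → (∀ i → p i ≡ false) → anyFin p ≡ false
anyFin-false p p≡false = ¬-not λ any-p → let i , pi = anyFin⁻ p any-p in
  contradiction (trans (sym (p≡false i)) pi) λ ()

maxL-upper : ∀ {x} xs → x ∈ xs → x ≤ maxL xs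
maxL-upper (y ∷ [])     (here refl)          = ≤-refl
maxL-upper (y ∷ z ∷ zs) (here refl)          = ≤-trans (maxL-upper (y ∷ zs) (here refl)) (p≤q⊔p z _)
maxL-upper (y ∷ z ∷ zs) (there (here refl))  = p≤p⊔q z _
maxL-upper (y ∷ z ∷ zs) (there (there x∈zs)) = ≤-trans (maxL-upper (y ∷ zs) (there x∈zs)) (p≤q⊔p z _)

maxL-∈ : ∀ y ys → maxL (y ∷ ys) ∈ y ∷ ys
maxL-∈ y ys = [ here , there ]′ (foldr-selective {_•_ = _⊔_} ⊔-sel y ys)

legalMoves : Board (suc n) → List (Fin (suc n))
legalMoves g = filter (λ v → T? (legal g v)) (allFin _)

move : Board (suc n) → Fin (suc n) → ℚ
move g v = wt g v - val (delete g v)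

∈-legalMoves : (g : Board (suc n)) {v : Fin (suc n)} → legal g v ≡ true → v ∈ legalMoves g
∈-legalMoves g {v} v-legal = ∈-filter⁺ (λ v → T? (legal g v)) (∈-allFin v) (Equivalence.from T-≡ v-legal)

legal-exists : (g : Board (suc n)) → ∃ λ v → legal g v ≡ true
legal-exists {n} g with unbroached g zero in unbroached≡
... | true  = zero , ∨-trueʳ (avail g zero) unbroached≡
... | false with anyFin⁻ (λ w → reach g (suc n) zero w ∧ avail g w) (not-false⁻ unbroached≡)
...   | w , reach∧avail = w , ∨-trueˡ (proj₂ (∧-true⁻ (reach g (suc n) zero w) reach∧avail))

move≤val : (g : Board (suc n)) {v : Fin (suc n)} → legal g v ≡ true → move g v ≤ val g
move≤val g v-legal = maxL-upper _ (∈-map⁺ (move g) (∈-legalMoves g v-legal))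

val-attained : (g : Board (suc n)) → ∃ λ v → legal g v ≡ true × val g ≡ move g v
val-attained g with legalMoves g in moves≡ | legal-exists g
... | [] | v , v-legal = contradiction (subst (v ∈_) moves≡ (∈-legalMoves g v-legal)) λ ()
... | u ∷ us | _ with ∈-map⁻ (move g) (maxL-∈ (move g u) (map (move g) us))
...   | v , v∈ , val≡ =
  v , Equivalence.to T-≡ (proj₂ (∈-filter⁻ (λ v → T? (legal g v)) (subst (v ∈_) (sym moves≡) v∈))) , val≡

val-empty : (k : Board n) → n ≡ 0 → val k ≡ 0ℚ
val-empty k refl = refl

-- Reachability

module _ {n : ℕ} (P : ℕ → Subset n) (P-step : ∀ k → P k ⊆ₛ P (suc k)) where

  chain-mono : ∀ {k l} → k ≤′ l → P k ⊆ₛ P l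
  chain-mono ≤′-refl        x∈ = x∈
  chain-mono (≤′-step k≤′l) x∈ = P-step _ (chain-mono k≤′l x∈)

  chain-grows : ∀ k → (∃ λ j → j ℕ.< k × P (suc j) ⊆ₛ P j) ⊎ k ℕ.≤ ∣ P k ∣
  chain-grows zero = inj₂ z≤n
  chain-grows (suc k) with chain-grows k
  ... | inj₁ (j , j<k , stalls) = inj₁ (j , ℕ.m<n⇒m<1+n j<k , stalls)
  ... | inj₂ k≤∣Pk∣ with P k ⊂? P (suc k)
  ...   | yes Pk⊂ = inj₂ (ℕ.≤-<-trans k≤∣Pk∣ (p⊂q⇒∣p∣<∣q∣ Pk⊂))
  ...   | no ¬Pk⊂ = inj₁ (k , ℕ.n<1+n k , λ {x} x∈ →
                      decidable-stable (x ∈? P k) (λ x∉ → ¬Pk⊂ (P-step k , x , x∈ , x∉)))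

  -- The chain stalls at some j ≤ n by chain-grows, and the hypothesis keeps it constant after j.
  chain-stabilises : (∀ k → P (suc k) ⊆ₛ P k → P (suc (suc k)) ⊆ₛ P (suc k)) → ∀ k → P k ⊆ₛ P n
  chain-stabilises P-stable k with chain-grows (suc n)
  ... | inj₂ 1+n≤∣P∣ = contradiction (ℕ.≤-trans 1+n≤∣P∣ (∣p∣≤n (P (suc n)))) ℕ.1+n≰n
  ... | inj₁ (j , j<1+n , stalls) =
    λ x∈ → chain-mono (ℕ.≤⇒≤′ (ℕ.≤-pred j<1+n)) (stays k (chain-mono (ℕ.≤⇒≤′ (ℕ.m≤m+n k j)) x∈))
    where
    stalls-after : ∀ t → P (suc (t + j)) ⊆ₛ P (t + j)
    stalls-after zero    = stalls
    stalls-after (suc t) = P-stable (t + j) (stalls-after t)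

    stays : ∀ t → P (t + j) ⊆ₛ P j
    stays zero    x∈ = x∈
    stays (suc t) x∈ = stays t (stalls-after t x∈)

∈-tabulate⁺ : (f : Fin n → Bool) {x : Fin n} → f x ≡ true → x ∈ₛ tabulate f
∈-tabulate⁺ f {x} fx≡true = lookup⇒[]= x (tabulate f) (trans (lookup∘tabulate f x) fx≡true)

∈-tabulate⁻ : (f : Fin n → Bool) {x : Fin n} → x ∈ₛ tabulate f → f x ≡ true
∈-tabulate⁻ f {x} x∈ = trans (sym (lookup∘tabulate f x)) ([]=⇒lookup x∈)

reachable : Board n → Fin n → ℕ → Subset n
reachable g u k = tabulate (reach g k u)

module _ (g : Board n) (u : Fin n) where

  reachable-step : ∀ k → reachable g u k ⊆ₛ reachable g u (suc k)
  reachable-step k x∈ = ∈-tabulate⁺ _ (∨-trueˡ (∈-tabulate⁻ _ x∈))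

  reachable-stalls : ∀ k → reachable g u (suc k) ⊆ₛ reachable g u k →
                     reachable g u (suc (suc k)) ⊆ₛ reachable g u (suc k)
  reachable-stalls k stalls {w} w∈ with ∨-true⁻ (reach g (suc k) u w) (∈-tabulate⁻ _ w∈)
  ... | inj₁ reached = ∈-tabulate⁺ _ reached
  ... | inj₂ via-edge with anyFin⁻ (λ x → reach g (suc k) u x ∧ adj g x w) via-edge
  ...   | x , x-reached∧edge with ∧-true⁻ (reach g (suc k) u x) x-reached∧edge
  ...     | x-reached , edge =
    ∈-tabulate⁺ _ (∨-trueʳ (reach g k u w) (anyFin⁺ (λ x → reach g k u x ∧ adj g x w)
      (∧-true⁺ (∈-tabulate⁻ _ (stalls (∈-tabulate⁺ _ x-reached))) edge)))

  reach-saturated : ∀ {k} w → n ℕ.≤ k → reach g k u w ≡ reach g n u w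
  reach-saturated {k} w n≤k = ⇔→≡ (mk⇔
    (λ reached → ∈-tabulate⁻ _ (chain-stabilises (reachable g u) reachable-step reachable-stalls k
                                  (∈-tabulate⁺ _ reached)))
    (λ reached → ∈-tabulate⁻ _ (chain-mono (reachable g u) reachable-step (ℕ.≤⇒≤′ n≤k)
                                  (∈-tabulate⁺ _ reached))))

-- Relabelling vertices

record _≅_ (B : Board m) (B' : Board n) : Set where
  field
    to       : Fin m → Fin n
    from     : Fin n → Fin m
    to-from  : ∀ j → to (from j) ≡ j
    from-to  : ∀ i → from (to i) ≡ i
    adj-to   : ∀ i j → adj B' (to i) (to j) ≡ adj B i j
    wt-to    : ∀ i → wt B' (to i) ≡ wt B i
    avail-to : ∀ i → avail B' (to i) ≡ avail B i

  to-injective : ∀ {i j} → to i ≡ to j → i ≡ j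
  to-injective {i} {j} to-i≡to-j = trans (sym (from-to i)) (trans (cong from to-i≡to-j) (from-to j))
open _≅_

infix 4 _≅_

≅-refl : (B : Board m) → B ≅ B
≅-refl B = record
  { to = λ i → i ; from = λ i → i ; to-from = λ _ → refl ; from-to = λ _ → refl
  ; adj-to = λ _ _ → refl ; wt-to = λ _ → refl ; avail-to = λ _ → refl }

≅-sym : {B : Board m} {B' : Board n} → B ≅ B' → B' ≅ B
≅-sym {B' = B'} I = record
  { to = from I ; from = to I ; to-from = from-to I ; from-to = to-from I
  ; adj-to   = λ i j → trans (sym (adj-to I _ _)) (cong₂ (adj B') (to-from I i) (to-from I j))
  ; wt-to    = λ i → trans (sym (wt-to I _)) (cong (wt B') (to-from I i))
  ; avail-to = λ i → trans (sym (avail-to I _)) (cong (avail B') (to-from I i)) }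

≅-trans : {B : Board m} {B' : Board n} {B'' : Board o} → B ≅ B' → B' ≅ B'' → B ≅ B''
≅-trans I J = record
  { to = to J ∘ to I ; from = from I ∘ from J
  ; to-from  = λ k → trans (cong (to J) (to-from I (from J k))) (to-from J k)
  ; from-to  = λ i → trans (cong (from I) (from-to J (to I i))) (from-to I i)
  ; adj-to   = λ i j → trans (adj-to J _ _) (adj-to I i j)
  ; wt-to    = λ i → trans (wt-to J _) (wt-to I i)
  ; avail-to = λ i → trans (avail-to J _) (avail-to I i) }

module _ {B : Board m} {B' : Board n} (I : B ≅ B') where

  reach-≅ : ∀ k u w → reach B' k (to I u) (to I w) ≡ reach B k u w
  reach-≅ zero    u w = ⌊≟⌋-∘-injective (to I) (to-injective I) u w
  reach-≅ (suc k) u w = cong₂ _∨_ (reach-≅ k u w)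
    (anyFin-reindex (to I) (from I) (to-from I) _ _ λ x → cong₂ _∧_ (reach-≅ k u x) (adj-to I x w))

  unbroached-≅ : ∀ v → unbroached B' (to I v) ≡ unbroached B v
  unbroached-≅ v = cong not
    (anyFin-reindex (to I) (from I) (to-from I) _ _ λ w → cong₂ _∧_ (reach-in-own-size w) (avail-to I w))
    where
    reach-in-own-size : ∀ w → reach B' n (to I v) (to I w) ≡ reach B m v w
    reach-in-own-size w = begin
      reach B' n       (to I v) (to I w) ≡⟨ reach-saturated B' (to I v) (to I w) (ℕ.m≤n+m n m) ⟨
      reach B' (m + n) (to I v) (to I w) ≡⟨ reach-≅ (m + n) v w ⟩
      reach B  (m + n) v w               ≡⟨ reach-saturated B v w (ℕ.m≤m+n m n) ⟩
      reach B  m       v w               ∎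
      where open ≡-Reasoning

  legal-≅ : ∀ v → legal B' (to I v) ≡ legal B v
  legal-≅ v = cong₂ _∨_ (avail-to I v) (unbroached-≅ v)

-- Deleting a vertex

-- D is B with v removed, up to relabelling. Unlike delete, this also makes sense for boards
-- whose size is not syntactically a successor, such as a ⊕ b with b nonempty.
record Deletion (B : Board m) (v : Fin m) (D : Board n) : Set where
  field
    embed           : Fin n → Fin m
    embed-injective : ∀ {i j} → embed i ≡ embed j → i ≡ j
    embed-≢         : ∀ i → embed i ≢ v
    embed-onto      : ∀ j → j ≢ v → ∃ λ i → embed i ≡ j
    adj-embed       : ∀ i j → adj D i j ≡ adj B (embed i) (embed j)
    wt-embed        : ∀ i → wt D i ≡ wt B (embed i)
    avail-embed     : ∀ i → avail D i ≡ avail B (embed i) ∨ adj B v (embed i)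
open Deletion

delete-deletion : (B : Board (suc m)) (v : Fin (suc m)) → Deletion B v (delete B v)
delete-deletion B v = record
  { embed = punchIn v ; embed-injective = punchIn-injective v _ _ ; embed-≢ = punchInᵢ≢i v
  ; embed-onto = λ j j≢v → punchOut (j≢v ∘ sym) , punchIn-punchOut _
  ; adj-embed = λ _ _ → refl ; wt-embed = λ _ → refl ; avail-embed = λ _ → refl }

deletion-unique : {B : Board m} {v : Fin m} {D : Board n} {D' : Board o} →
                  Deletion B v D → Deletion B v D' → D ≅ D'
deletion-unique {B = B} {v} d d' = record
  { to = match ; from = match⁻¹
  ; to-from  = λ j → embed-injective d' (trans (embed-match (match⁻¹ j)) (embed-match⁻¹ j))
  ; from-to  = λ i → embed-injective d (trans (embed-match⁻¹ (match i)) (embed-match i))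
  ; adj-to   = λ i j → trans (adj-embed d' _ _)
                         (trans (cong₂ (adj B) (embed-match i) (embed-match j)) (sym (adj-embed d i j)))
  ; wt-to    = λ i → trans (wt-embed d' _) (trans (cong (wt B) (embed-match i)) (sym (wt-embed d i)))
  ; avail-to = λ i → trans (avail-embed d' _)
                       (trans (cong (λ x → avail B x ∨ adj B v x) (embed-match i))
                              (sym (avail-embed d i))) }
  where
  match : Fin _ → Fin _
  match i = proj₁ (embed-onto d' (embed d i) (embed-≢ d i))
  match⁻¹ : Fin _ → Fin _
  match⁻¹ j = proj₁ (embed-onto d (embed d' j) (embed-≢ d' j))
  embed-match : ∀ i → embed d' (match i) ≡ embed d i
  embed-match i = proj₂ (embed-onto d' (embed d i) (embed-≢ d i))
  embed-match⁻¹ : ∀ j → embed d (match⁻¹ j) ≡ embed d' j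
  embed-match⁻¹ j = proj₂ (embed-onto d (embed d' j) (embed-≢ d' j))

deletion-≅ˡ : {B : Board m} {B' : Board n} {v : Fin m} {D : Board o} →
              (I : B ≅ B') → Deletion B v D → Deletion B' (to I v) D
deletion-≅ˡ I d = record
  { embed = to I ∘ embed d
  ; embed-injective = embed-injective d ∘ to-injective I
  ; embed-≢ = λ i → embed-≢ d i ∘ to-injective I
  ; embed-onto = λ j j≢ → let i , embed≡ = embed-onto d (from I j) (j≢ ∘ to-from-≡ j) in
                          i , trans (cong (to I) embed≡) (to-from I j)
  ; adj-embed = λ i j → trans (adj-embed d i j) (sym (adj-to I _ _))
  ; wt-embed = λ i → trans (wt-embed d i) (sym (wt-to I _))
  ; avail-embed = λ i → trans (avail-embed d i) (sym (cong₂ _∨_ (avail-to I _) (adj-to I _ _))) }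
  where
  to-from-≡ : ∀ j {v} → from I j ≡ v → j ≡ to I v
  to-from-≡ j from≡ = trans (sym (to-from I j)) (cong (to I) from≡)

deletion-≅ʳ : {B : Board m} {v : Fin m} {D : Board n} {D' : Board o} →
              Deletion B v D → D ≅ D' → Deletion B v D'
deletion-≅ʳ d I = record
  { embed = embed d ∘ from I
  ; embed-injective = λ embed≡ →
      trans (sym (to-from I _)) (trans (cong (to I) (embed-injective d embed≡)) (to-from I _))
  ; embed-≢ = embed-≢ d ∘ from I
  ; embed-onto = λ j j≢ → let i , embed≡ = embed-onto d j j≢ in
                          to I i , trans (cong (embed d) (from-to I i)) embed≡
  ; adj-embed = λ i j → trans (sym (adj-to (≅-sym I) i j)) (adj-embed d _ _)
  ; wt-embed = λ i → trans (sym (wt-to (≅-sym I) i)) (wt-embed d _)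
  ; avail-embed = λ i → trans (sym (avail-to (≅-sym I) i)) (avail-embed d _) }

delete-≅ : {B : Board (suc m)} {B' : Board (suc n)} (I : B ≅ B') (v : Fin (suc m)) →
           delete B v ≅ delete B' (to I v)
delete-≅ {B = B} {B'} I v =
  deletion-unique (deletion-≅ˡ I (delete-deletion B v)) (delete-deletion B' (to I v))

val-≅ : {B : Board m} {B' : Board n} → B ≅ B' → val B ≡ val B'
val-≅-≤ : {B : Board (suc m)} {B' : Board (suc n)} → B ≅ B' → val B ≤ val B'

val-≅ {zero}  {zero}  I = refl
val-≅ {zero}  {suc n} I with () ← from I zero
val-≅ {suc m} {zero}  I with () ← to I zero
val-≅ {suc _} {suc _} I = ≤-antisym (val-≅-≤ I) (val-≅-≤ (≅-sym I))

val-≅-≤ {B = B} {B'} I with val-attained B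
... | v , v-legal , val≡move = begin
  val B                                     ≡⟨ val≡move ⟩
  wt B v - val (delete B v)                 ≡⟨ cong₂ _-_ (sym (wt-to I v)) (val-≅ (delete-≅ I v)) ⟩
  wt B' (to I v) - val (delete B' (to I v)) ≤⟨ move≤val B' (trans (legal-≅ I v) v-legal) ⟩
  val B'                                    ∎
  where open ≤-Reasoning

val-deletion : {B : Board (suc m)} {v : Fin (suc m)} {D : Board n} →
               Deletion B v D → val (delete B v) ≡ val D
val-deletion {B = B} {v} d = val-≅ (deletion-unique (delete-deletion B v) d)

MoveAtMost : Board m → Fin m → ℚ → Set
MoveAtMost B v c = ∃ λ n → ∃ λ (D : Board n) → Deletion B v D × wt B v - val D ≤ c

deletion-move≤val : {B : Board m} {v : Fin m} {D : Board n} →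
                    Deletion B v D → legal B v ≡ true → wt B v - val D ≤ val B
deletion-move≤val {suc _} {B = B} {v} d v-legal =
  subst (λ x → wt B v - x ≤ val B) (val-deletion d) (move≤val B v-legal)

val≤⁺ : (B : Board m) (c : ℚ) → (m ≡ 0 → 0ℚ ≤ c) →
        (∀ v → legal B v ≡ true → MoveAtMost B v c) → val B ≤ c
val≤⁺ {zero}  B c empty-bound _ = empty-bound refl
val≤⁺ {suc m} B c _ moves≤ with val-attained B
... | v , v-legal , val≡move with moves≤ v v-legal
...   | _ , D , d , move≤c = begin
  val B                     ≡⟨ val≡move ⟩
  wt B v - val (delete B v) ≡⟨ cong (wt B v -_) (val-deletion d) ⟩
  wt B v - val D            ≤⟨ move≤c ⟩
  c                         ∎
  where open ≤-Reasoning

moveAtMost-≅ : {B : Board m} {B' : Board n} {v : Fin m} {c : ℚ} →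
               (I : B ≅ B') → MoveAtMost B v c → MoveAtMost B' (to I v) c
moveAtMost-≅ {v = v} {c} I (_ , D , d , move≤c) =
  _ , D , deletion-≅ˡ I d , subst (λ w → w - val D ≤ c) (sym (wt-to I v)) move≤c

-- Disjoint unions

data Split (m n : ℕ) : Fin (m + n) → Set where
  inˡ : (i : Fin m) → Split m n (i ↑ˡ n)
  inʳ : (j : Fin n) → Split m n (m ↑ʳ j)

split : ∀ m {n} (x : Fin (m + n)) → Split m n x
split m {n} x with splitAt m {n} x in splitAt≡
... | inj₁ i = subst (Split m n) (splitAt⁻¹-↑ˡ splitAt≡) (inˡ i)
... | inj₂ j = subst (Split m n) (splitAt⁻¹-↑ʳ splitAt≡) (inʳ j)

↑ˡ≢↑ʳ : (i : Fin m) (j : Fin n) → i ↑ˡ n ≢ m ↑ʳ j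
↑ˡ≢↑ʳ {m} {n} i j i↑ˡ≡j↑ʳ
  with () ← trans (sym (splitAt-↑ˡ m i n)) (trans (cong (splitAt m) i↑ˡ≡j↑ʳ) (splitAt-↑ʳ m n j))

anyFin-↑ˡ : (p : Fin (m + n) → Bool) → (∀ j → p (m ↑ʳ j) ≡ false) → anyFin p ≡ anyFin (λ i → p (i ↑ˡ n))
anyFin-↑ˡ {m} {n} p right-false = ⇔→≡ (mk⇔ into (anyFin⁺ p ∘ proj₂ ∘ anyFin⁻ (λ i → p (i ↑ˡ n))))
  where
  into : anyFin p ≡ true → anyFin (λ i → p (i ↑ˡ n)) ≡ true
  into any-p with anyFin⁻ p any-p
  ... | x , px with split m x
  ...   | inˡ i = anyFin⁺ (λ i → p (i ↑ˡ n)) px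
  ...   | inʳ j = contradiction (trans (sym (right-false j)) px) λ ()

module _ (a : Board m) (b : Board n) where

  adj-⊕ˡˡ : ∀ i j → adj (a ⊕ b) (i ↑ˡ n) (j ↑ˡ n) ≡ adj a i j
  adj-⊕ˡˡ i j rewrite splitAt-↑ˡ m i n | splitAt-↑ˡ m j n = refl

  adj-⊕ˡʳ : ∀ i j → adj (a ⊕ b) (i ↑ˡ n) (m ↑ʳ j) ≡ false
  adj-⊕ˡʳ i j rewrite splitAt-↑ˡ m i n | splitAt-↑ʳ m n j = refl

  adj-⊕ʳˡ : ∀ i j → adj (a ⊕ b) (m ↑ʳ i) (j ↑ˡ n) ≡ false
  adj-⊕ʳˡ i j rewrite splitAt-↑ʳ m n i | splitAt-↑ˡ m j n = refl

  adj-⊕ʳʳ : ∀ i j → adj (a ⊕ b) (m ↑ʳ i) (m ↑ʳ j) ≡ adj b i j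
  adj-⊕ʳʳ i j rewrite splitAt-↑ʳ m n i | splitAt-↑ʳ m n j = refl

  wt-⊕ˡ : ∀ i → wt (a ⊕ b) (i ↑ˡ n) ≡ wt a i
  wt-⊕ˡ i rewrite splitAt-↑ˡ m i n = refl

  wt-⊕ʳ : ∀ j → wt (a ⊕ b) (m ↑ʳ j) ≡ wt b j
  wt-⊕ʳ j rewrite splitAt-↑ʳ m n j = refl

  avail-⊕ˡ : ∀ i → avail (a ⊕ b) (i ↑ˡ n) ≡ avail a i
  avail-⊕ˡ i rewrite splitAt-↑ˡ m i n = refl

  avail-⊕ʳ : ∀ j → avail (a ⊕ b) (m ↑ʳ j) ≡ avail b j
  avail-⊕ʳ j rewrite splitAt-↑ʳ m n j = refl

record DisjointUnion (a : Board m) (b : Board n) (u : Board o) : Set where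
  field
    inl          : Fin m → Fin o
    inr          : Fin n → Fin o
    side         : Fin o → Fin m ⊎ Fin n
    side-inl     : ∀ i → side (inl i) ≡ inj₁ i
    side-inr     : ∀ j → side (inr j) ≡ inj₂ j
    inl-inr-side : ∀ x → [ inl , inr ]′ (side x) ≡ x
    adj-inl-inl  : ∀ i j → adj u (inl i) (inl j) ≡ adj a i j
    adj-inl-inr  : ∀ i j → adj u (inl i) (inr j) ≡ false
    adj-inr-inr  : ∀ i j → adj u (inr i) (inr j) ≡ adj b i j
    wt-inl       : ∀ i → wt u (inl i) ≡ wt a i
    wt-inr       : ∀ j → wt u (inr j) ≡ wt b j
    avail-inl    : ∀ i → avail u (inl i) ≡ avail a i
    avail-inr    : ∀ j → avail u (inr j) ≡ avail b j

module _ {a : Board m} {b : Board n} {u : Board o} (U : DisjointUnion a b u) where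
  open DisjointUnion U

  glue : Fin (m + n) → Fin o
  glue x = [ inl , inr ]′ (splitAt m x)

  glue-↑ˡ : ∀ i → glue (i ↑ˡ n) ≡ inl i
  glue-↑ˡ i = cong [ inl , inr ]′ (splitAt-↑ˡ m i n)

  glue-↑ʳ : ∀ j → glue (m ↑ʳ j) ≡ inr j
  glue-↑ʳ j = cong [ inl , inr ]′ (splitAt-↑ʳ m n j)

  ⊕-≅-union : a ⊕ b ≅ u
  ⊕-≅-union = record
    { to = glue ; from = λ y → join m n (side y)
    ; to-from = λ y → trans (cong [ inl , inr ]′ (splitAt-join m n (side y))) (inl-inr-side y)
    ; from-to = from-glue ; adj-to = adj-glue ; wt-to = wt-glue ; avail-to = avail-glue }
    where
    from-glue : ∀ x → join m n (side (glue x)) ≡ x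
    from-glue x with split m x
    ... | inˡ i = cong (join m n) (trans (cong side (glue-↑ˡ i)) (side-inl i))
    ... | inʳ j = cong (join m n) (trans (cong side (glue-↑ʳ j)) (side-inr j))

    adj-glue : ∀ x y → adj u (glue x) (glue y) ≡ adj (a ⊕ b) x y
    adj-glue x y with split m x | split m y
    ... | inˡ i | inˡ j rewrite glue-↑ˡ i | glue-↑ˡ j = trans (adj-inl-inl i j) (sym (adj-⊕ˡˡ a b i j))
    ... | inˡ i | inʳ j rewrite glue-↑ˡ i | glue-↑ʳ j = trans (adj-inl-inr i j) (sym (adj-⊕ˡʳ a b i j))
    ... | inʳ i | inˡ j rewrite glue-↑ʳ i | glue-↑ˡ j =
      trans (adj-sym u _ _) (trans (adj-inl-inr j i) (sym (adj-⊕ʳˡ a b i j)))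
    ... | inʳ i | inʳ j rewrite glue-↑ʳ i | glue-↑ʳ j = trans (adj-inr-inr i j) (sym (adj-⊕ʳʳ a b i j))

    wt-glue : ∀ x → wt u (glue x) ≡ wt (a ⊕ b) x
    wt-glue x with split m x
    ... | inˡ i rewrite glue-↑ˡ i = trans (wt-inl i) (sym (wt-⊕ˡ a b i))
    ... | inʳ j rewrite glue-↑ʳ j = trans (wt-inr j) (sym (wt-⊕ʳ a b j))

    avail-glue : ∀ x → avail u (glue x) ≡ avail (a ⊕ b) x
    avail-glue x with split m x
    ... | inˡ i rewrite glue-↑ˡ i = trans (avail-inl i) (sym (avail-⊕ˡ a b i))
    ... | inʳ j rewrite glue-↑ʳ j = trans (avail-inr j) (sym (avail-⊕ʳ a b j))

⊕-comm-union : (a : Board m) (b : Board n) → DisjointUnion a b (b ⊕ a)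
⊕-comm-union {m} {n} a b = record
  { inl = n ↑ʳ_ ; inr = _↑ˡ m ; side = swap ∘ splitAt n
  ; side-inl = λ i → cong swap (splitAt-↑ʳ n m i)
  ; side-inr = λ j → cong swap (splitAt-↑ˡ n j m)
  ; inl-inr-side = inl-inr-side
  ; adj-inl-inl = adj-⊕ʳʳ b a ; adj-inl-inr = adj-⊕ʳˡ b a ; adj-inr-inr = adj-⊕ˡˡ b a
  ; wt-inl = wt-⊕ʳ b a ; wt-inr = wt-⊕ˡ b a ; avail-inl = avail-⊕ʳ b a ; avail-inr = avail-⊕ˡ b a }
  where
  inl-inr-side : ∀ x → [ n ↑ʳ_ , _↑ˡ m ]′ (swap (splitAt n x)) ≡ x
  inl-inr-side x with split n x
  ... | inˡ j rewrite splitAt-↑ˡ n j m = refl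
  ... | inʳ i rewrite splitAt-↑ʳ n m i = refl

⊕-cong-union : {a : Board m} {a' : Board m'} {b : Board n} {b' : Board n'} →
               a ≅ a' → b ≅ b' → DisjointUnion a b (a' ⊕ b')
⊕-cong-union {m' = m'} {n' = n'} {a' = a'} {b' = b'} I J = record
  { inl = inl ; inr = inr ; side = side
  ; side-inl = λ i → trans (cong (Sum.map (from I) (from J)) (splitAt-↑ˡ m' (to I i) n'))
                           (cong inj₁ (from-to I i))
  ; side-inr = λ j → trans (cong (Sum.map (from I) (from J)) (splitAt-↑ʳ m' n' (to J j)))
                           (cong inj₂ (from-to J j))
  ; inl-inr-side = inl-inr-side
  ; adj-inl-inl = λ i j → trans (adj-⊕ˡˡ a' b' _ _) (adj-to I i j)
  ; adj-inl-inr = λ i j → adj-⊕ˡʳ a' b' _ _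
  ; adj-inr-inr = λ i j → trans (adj-⊕ʳʳ a' b' _ _) (adj-to J i j)
  ; wt-inl = λ i → trans (wt-⊕ˡ a' b' _) (wt-to I i)
  ; wt-inr = λ j → trans (wt-⊕ʳ a' b' _) (wt-to J j)
  ; avail-inl = λ i → trans (avail-⊕ˡ a' b' _) (avail-to I i)
  ; avail-inr = λ j → trans (avail-⊕ʳ a' b' _) (avail-to J j) }
  where
  inl : Fin _ → Fin (m' + n')
  inl i = to I i ↑ˡ n'

  inr : Fin _ → Fin (m' + n')
  inr j = m' ↑ʳ to J j

  side : Fin (m' + n') → Fin _ ⊎ Fin _
  side = Sum.map (from I) (from J) ∘ splitAt m'

  inl-inr-side : ∀ x → [ inl , inr ]′ (side x) ≡ x
  inl-inr-side x with split m' x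
  ... | inˡ i rewrite splitAt-↑ˡ m' i n' = cong (_↑ˡ n') (to-from I i)
  ... | inʳ j rewrite splitAt-↑ʳ m' n' j = cong (m' ↑ʳ_) (to-from J j)

⊕-assoc-union : (a : Board m) (b : Board n) (c : Board o) → DisjointUnion (a ⊕ b) c (a ⊕ (b ⊕ c))
⊕-assoc-union {m} {n} {o} a b c = record
  { inl = inl ; inr = λ k → m ↑ʳ (n ↑ʳ k) ; side = side
  ; side-inl = side-inl ; side-inr = side-inr ; inl-inr-side = inl-inr-side
  ; adj-inl-inl = adj-inl-inl ; adj-inl-inr = adj-inl-inr
  ; adj-inr-inr = λ i j → trans (adj-⊕ʳʳ a (b ⊕ c) _ _) (adj-⊕ʳʳ b c i j)
  ; wt-inl = wt-inl ; wt-inr = λ k → trans (wt-⊕ʳ a (b ⊕ c) _) (wt-⊕ʳ b c k)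
  ; avail-inl = avail-inl ; avail-inr = λ k → trans (avail-⊕ʳ a (b ⊕ c) _) (avail-⊕ʳ b c k) }
  where
  inl : Fin (m + n) → Fin (m + (n + o))
  inl x = [ _↑ˡ (n + o) , (λ j → m ↑ʳ (j ↑ˡ o)) ]′ (splitAt m x)

  inl-↑ˡ : ∀ i → inl (i ↑ˡ n) ≡ i ↑ˡ (n + o)
  inl-↑ˡ i rewrite splitAt-↑ˡ m i n = refl

  inl-↑ʳ : ∀ j → inl (m ↑ʳ j) ≡ m ↑ʳ (j ↑ˡ o)
  inl-↑ʳ j rewrite splitAt-↑ʳ m n j = refl

  side : Fin (m + (n + o)) → Fin (m + n) ⊎ Fin o
  side y = [ (λ i → inj₁ (i ↑ˡ n)) , (λ z → Sum.map₁ (m ↑ʳ_) (splitAt n z)) ]′ (splitAt m y)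

  side-inl : ∀ x → side (inl x) ≡ inj₁ x
  side-inl x with split m x
  ... | inˡ i rewrite inl-↑ˡ i | splitAt-↑ˡ m i (n + o) = refl
  ... | inʳ j rewrite inl-↑ʳ j | splitAt-↑ʳ m (n + o) (j ↑ˡ o) | splitAt-↑ˡ n j o = refl

  side-inr : ∀ k → side (m ↑ʳ (n ↑ʳ k)) ≡ inj₂ k
  side-inr k rewrite splitAt-↑ʳ m (n + o) (n ↑ʳ k) | splitAt-↑ʳ n o k = refl

  inl-inr-side : ∀ y → [ inl , (λ k → m ↑ʳ (n ↑ʳ k)) ]′ (side y) ≡ y
  inl-inr-side y with split m y
  ... | inˡ i rewrite splitAt-↑ˡ m i (n + o) = inl-↑ˡ i
  ... | inʳ z with split n z
  ...   | inˡ j rewrite splitAt-↑ʳ m (n + o) (j ↑ˡ o) | splitAt-↑ˡ n j o = inl-↑ʳ j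
  ...   | inʳ k rewrite splitAt-↑ʳ m (n + o) (n ↑ʳ k) | splitAt-↑ʳ n o k = refl

  adj-inl-inl : ∀ x y → adj (a ⊕ (b ⊕ c)) (inl x) (inl y) ≡ adj (a ⊕ b) x y
  adj-inl-inl x y with split m x | split m y
  ... | inˡ i | inˡ j rewrite inl-↑ˡ i | inl-↑ˡ j =
    trans (adj-⊕ˡˡ a (b ⊕ c) i j) (sym (adj-⊕ˡˡ a b i j))
  ... | inˡ i | inʳ j rewrite inl-↑ˡ i | inl-↑ʳ j =
    trans (adj-⊕ˡʳ a (b ⊕ c) i _) (sym (adj-⊕ˡʳ a b i j))
  ... | inʳ i | inˡ j rewrite inl-↑ʳ i | inl-↑ˡ j =
    trans (adj-⊕ʳˡ a (b ⊕ c) _ j) (sym (adj-⊕ʳˡ a b i j))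
  ... | inʳ i | inʳ j rewrite inl-↑ʳ i | inl-↑ʳ j =
    trans (adj-⊕ʳʳ a (b ⊕ c) _ _) (trans (adj-⊕ˡˡ b c i j) (sym (adj-⊕ʳʳ a b i j)))

  adj-inl-inr : ∀ x k → adj (a ⊕ (b ⊕ c)) (inl x) (m ↑ʳ (n ↑ʳ k)) ≡ false
  adj-inl-inr x k with split m x
  ... | inˡ i rewrite inl-↑ˡ i = adj-⊕ˡʳ a (b ⊕ c) i _
  ... | inʳ j rewrite inl-↑ʳ j = trans (adj-⊕ʳʳ a (b ⊕ c) _ _) (adj-⊕ˡʳ b c j k)

  wt-inl : ∀ x → wt (a ⊕ (b ⊕ c)) (inl x) ≡ wt (a ⊕ b) x
  wt-inl x with split m x
  ... | inˡ i rewrite inl-↑ˡ i = trans (wt-⊕ˡ a (b ⊕ c) i) (sym (wt-⊕ˡ a b i))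
  ... | inʳ j rewrite inl-↑ʳ j =
    trans (wt-⊕ʳ a (b ⊕ c) _) (trans (wt-⊕ˡ b c j) (sym (wt-⊕ʳ a b j)))

  avail-inl : ∀ x → avail (a ⊕ (b ⊕ c)) (inl x) ≡ avail (a ⊕ b) x
  avail-inl x with split m x
  ... | inˡ i rewrite inl-↑ˡ i = trans (avail-⊕ˡ a (b ⊕ c) i) (sym (avail-⊕ˡ a b i))
  ... | inʳ j rewrite inl-↑ʳ j =
    trans (avail-⊕ʳ a (b ⊕ c) _) (trans (avail-⊕ˡ b c j) (sym (avail-⊕ʳ a b j)))

⊕-comm : (a : Board m) (b : Board n) → a ⊕ b ≅ b ⊕ a
⊕-comm a b = ⊕-≅-union (⊕-comm-union a b)

⊕-cong : {a : Board m} {a' : Board m'} {b : Board n} {b' : Board n'} →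
         a ≅ a' → b ≅ b' → a ⊕ b ≅ a' ⊕ b'
⊕-cong I J = ⊕-≅-union (⊕-cong-union I J)

⊕-assoc : (a : Board m) (b : Board n) (c : Board o) → (a ⊕ b) ⊕ c ≅ a ⊕ (b ⊕ c)
⊕-assoc a b c = ⊕-≅-union (⊕-assoc-union a b c)

module ≅-Reasoning where
  infix  1 begin_
  infixr 2 _≅⟨_⟩_
  infix  3 _∎

  begin_ : {B : Board m} {B' : Board n} → B ≅ B' → B ≅ B'
  begin I = I

  _≅⟨_⟩_ : (B : Board m) {B' : Board n} {B'' : Board o} → B ≅ B' → B' ≅ B'' → B ≅ B''
  B ≅⟨ I ⟩ J = ≅-trans I J

  _∎ : (B : Board m) → B ≅ B
  B ∎ = ≅-refl B

⊕-medial : (a : Board m) (b : Board n) (c : Board o) (d : Board l) →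
           (a ⊕ b) ⊕ (c ⊕ d) ≅ (a ⊕ c) ⊕ (b ⊕ d)
⊕-medial a b c d = begin
  (a ⊕ b) ⊕ (c ⊕ d)  ≅⟨ ⊕-assoc a b (c ⊕ d) ⟩
  a ⊕ (b ⊕ (c ⊕ d))  ≅⟨ ⊕-cong (≅-refl a) (≅-sym (⊕-assoc b c d)) ⟩
  a ⊕ ((b ⊕ c) ⊕ d)  ≅⟨ ⊕-cong (≅-refl a) (⊕-cong (⊕-comm b c) (≅-refl d)) ⟩
  a ⊕ ((c ⊕ b) ⊕ d)  ≅⟨ ⊕-cong (≅-refl a) (⊕-assoc c b d) ⟩
  a ⊕ (c ⊕ (b ⊕ d))  ≅⟨ ≅-sym (⊕-assoc a c (b ⊕ d)) ⟩
  (a ⊕ c) ⊕ (b ⊕ d)  ∎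
  where open ≅-Reasoning

⊕-pair-up : (g : Board m) (h : Board n) (c : Board o) →
            (g ⊕ h) ⊕ ((g ⊕ h) ⊕ c) ≅ (h ⊕ h) ⊕ ((g ⊕ g) ⊕ c)
⊕-pair-up g h c = begin
  (g ⊕ h) ⊕ ((g ⊕ h) ⊕ c)  ≅⟨ ≅-sym (⊕-assoc (g ⊕ h) (g ⊕ h) c) ⟩
  ((g ⊕ h) ⊕ (g ⊕ h)) ⊕ c  ≅⟨ ⊕-cong (⊕-medial g h g h) (≅-refl c) ⟩
  ((g ⊕ g) ⊕ (h ⊕ h)) ⊕ c  ≅⟨ ⊕-cong (⊕-comm (g ⊕ g) (h ⊕ h)) (≅-refl c) ⟩
  ((h ⊕ h) ⊕ (g ⊕ g)) ⊕ c  ≅⟨ ⊕-assoc (h ⊕ h) (g ⊕ g) c ⟩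
  (h ⊕ h) ⊕ ((g ⊕ g) ⊕ c)  ∎
  where open ≅-Reasoning

module _ (a : Board m) (b : Board n) where

  reach-⊕ˡˡ : ∀ k u w → reach (a ⊕ b) k (u ↑ˡ n) (w ↑ˡ n) ≡ reach a k u w
  reach-⊕ˡʳ : ∀ k u w → reach (a ⊕ b) k (u ↑ˡ n) (m ↑ʳ w) ≡ false

  reach-⊕ˡˡ zero    u w = ⌊≟⌋-∘-injective (_↑ˡ n) (↑ˡ-injective n _ _) u w
  reach-⊕ˡˡ (suc k) u w = cong₂ _∨_ (reach-⊕ˡˡ k u w) (begin
    anyFin step                      ≡⟨ anyFin-↑ˡ step (λ y → cong (_∧ _) (reach-⊕ˡʳ k u y)) ⟩
    anyFin (λ x → step (x ↑ˡ n))     ≡⟨ anyFin-cong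
                                          (λ x → cong₂ _∧_ (reach-⊕ˡˡ k u x) (adj-⊕ˡˡ a b x w)) ⟩
    anyFin (λ x → reach a k u x ∧ adj a x w) ∎)
    where
    open ≡-Reasoning
    step : Fin (m + n) → Bool
    step x = reach (a ⊕ b) k (u ↑ˡ n) x ∧ adj (a ⊕ b) x (w ↑ˡ n)

  reach-⊕ˡʳ zero    u w = ¬-not λ u≟w → ↑ˡ≢↑ʳ u w (toWitness (Equivalence.from T-≡ u≟w))
  reach-⊕ˡʳ (suc k) u w = cong₂ _∨_ (reach-⊕ˡʳ k u w)
    (trans (anyFin-↑ˡ step (λ y → cong (_∧ _) (reach-⊕ˡʳ k u y)))
           (anyFin-false (λ x → step (x ↑ˡ n))
                         (λ x → trans (cong (_ ∧_) (adj-⊕ˡʳ a b x w)) (∧-zeroʳ _))))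
    where
    step : Fin (m + n) → Bool
    step x = reach (a ⊕ b) k (u ↑ˡ n) x ∧ adj (a ⊕ b) x (m ↑ʳ w)

  legal-⊕ˡ : ∀ v → legal (a ⊕ b) (v ↑ˡ n) ≡ legal a v
  legal-⊕ˡ v = cong₂ _∨_ (avail-⊕ˡ a b v) (cong not (begin
    anyFin reaches-available                    ≡⟨ anyFin-↑ˡ reaches-available
                                                     (λ w → cong (_∧ _) (reach-⊕ˡʳ (m + n) v w)) ⟩
    anyFin (λ w → reaches-available (w ↑ˡ n))   ≡⟨ anyFin-cong
                                                     (λ w → cong₂ _∧_ (reach-in-a w) (avail-⊕ˡ a b w)) ⟩
    anyFin (λ w → reach a m v w ∧ avail a w)    ∎))
    where
    open ≡-Reasoning
    reaches-available : Fin (m + n) → Bool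
    reaches-available w = reach (a ⊕ b) (m + n) (v ↑ˡ n) w ∧ avail (a ⊕ b) w
    reach-in-a : ∀ w → reach (a ⊕ b) (m + n) (v ↑ˡ n) (w ↑ˡ n) ≡ reach a m v w
    reach-in-a w = trans (reach-⊕ˡˡ (m + n) v w) (reach-saturated a v w (ℕ.m≤m+n m n))

legal-⊕ʳ : (a : Board m) (b : Board n) (v : Fin n) → legal (a ⊕ b) (m ↑ʳ v) ≡ legal b v
legal-⊕ʳ {m} a b v = begin
  legal (a ⊕ b) (m ↑ʳ v)                  ≡⟨ cong (legal (a ⊕ b)) (glue-↑ˡ (⊕-comm-union b a) v) ⟨
  legal (a ⊕ b) (to (⊕-comm b a) (v ↑ˡ m)) ≡⟨ legal-≅ (⊕-comm b a) (v ↑ˡ m) ⟩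
  legal (b ⊕ a) (v ↑ˡ m)                  ≡⟨ legal-⊕ˡ b a v ⟩
  legal b v                               ∎
  where open ≡-Reasoning

deletion-⊕ˡ : {a : Board m} {v : Fin m} {a' : Board n} → Deletion a v a' → (b : Board o) →
              Deletion (a ⊕ b) (v ↑ˡ o) (a' ⊕ b)
deletion-⊕ˡ {m} {n} {o} {a} {v} {a'} d b = record
  { embed = embed′ ; embed-injective = λ {x} {y} → injective x y ; embed-≢ = ≢v ; embed-onto = onto
  ; adj-embed = adj-embed′ ; wt-embed = wt-embed′ ; avail-embed = avail-embed′ }
  where
  embed′ : Fin (n + o) → Fin (m + o)
  embed′ x = [ (λ i → embed d i ↑ˡ o) , m ↑ʳ_ ]′ (splitAt n x)

  embed-↑ˡ : ∀ i → embed′ (i ↑ˡ o) ≡ embed d i ↑ˡ o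
  embed-↑ˡ i rewrite splitAt-↑ˡ n i o = refl

  embed-↑ʳ : ∀ j → embed′ (n ↑ʳ j) ≡ m ↑ʳ j
  embed-↑ʳ j rewrite splitAt-↑ʳ n o j = refl

  injective : ∀ x y → embed′ x ≡ embed′ y → x ≡ y
  injective x y embed≡ with split n x | split n y
  ... | inˡ i | inˡ j = cong (_↑ˡ o) (embed-injective d (↑ˡ-injective o _ _
                          (trans (sym (embed-↑ˡ i)) (trans embed≡ (embed-↑ˡ j)))))
  ... | inˡ i | inʳ j =
    contradiction (trans (sym (embed-↑ˡ i)) (trans embed≡ (embed-↑ʳ j))) (↑ˡ≢↑ʳ _ _)
  ... | inʳ i | inˡ j =
    contradiction (trans (sym (embed-↑ˡ j)) (trans (sym embed≡) (embed-↑ʳ i))) (↑ˡ≢↑ʳ _ _)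
  ... | inʳ i | inʳ j = cong (n ↑ʳ_) (↑ʳ-injective m _ _
                          (trans (sym (embed-↑ʳ i)) (trans embed≡ (embed-↑ʳ j))))

  ≢v : ∀ x → embed′ x ≢ v ↑ˡ o
  ≢v x with split n x
  ... | inˡ i = λ embed≡ → embed-≢ d i (↑ˡ-injective o _ _ (trans (sym (embed-↑ˡ i)) embed≡))
  ... | inʳ j = λ embed≡ → ↑ˡ≢↑ʳ v j (sym (trans (sym (embed-↑ʳ j)) embed≡))

  onto : ∀ y → y ≢ v ↑ˡ o → ∃ λ x → embed′ x ≡ y
  onto y y≢ with split m y
  ... | inˡ i = let i' , embed≡ = embed-onto d i (y≢ ∘ cong (_↑ˡ o)) in
                i' ↑ˡ o , trans (embed-↑ˡ i') (cong (_↑ˡ o) embed≡)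
  ... | inʳ j = n ↑ʳ j , embed-↑ʳ j

  adj-embed′ : ∀ x y → adj (a' ⊕ b) x y ≡ adj (a ⊕ b) (embed′ x) (embed′ y)
  adj-embed′ x y with split n x | split n y
  ... | inˡ i | inˡ j rewrite embed-↑ˡ i | embed-↑ˡ j =
    trans (adj-⊕ˡˡ a' b i j) (trans (adj-embed d i j) (sym (adj-⊕ˡˡ a b _ _)))
  ... | inˡ i | inʳ j rewrite embed-↑ˡ i | embed-↑ʳ j =
    trans (adj-⊕ˡʳ a' b i j) (sym (adj-⊕ˡʳ a b _ j))
  ... | inʳ i | inˡ j rewrite embed-↑ʳ i | embed-↑ˡ j =
    trans (adj-⊕ʳˡ a' b i j) (sym (adj-⊕ʳˡ a b i _))
  ... | inʳ i | inʳ j rewrite embed-↑ʳ i | embed-↑ʳ j =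
    trans (adj-⊕ʳʳ a' b i j) (sym (adj-⊕ʳʳ a b i j))

  wt-embed′ : ∀ x → wt (a' ⊕ b) x ≡ wt (a ⊕ b) (embed′ x)
  wt-embed′ x with split n x
  ... | inˡ i rewrite embed-↑ˡ i =
    trans (wt-⊕ˡ a' b i) (trans (wt-embed d i) (sym (wt-⊕ˡ a b _)))
  ... | inʳ j rewrite embed-↑ʳ j = trans (wt-⊕ʳ a' b j) (sym (wt-⊕ʳ a b j))

  avail-embed′ : ∀ x →
                 avail (a' ⊕ b) x ≡ avail (a ⊕ b) (embed′ x) ∨ adj (a ⊕ b) (v ↑ˡ o) (embed′ x)
  avail-embed′ x with split n x
  ... | inˡ i rewrite embed-↑ˡ i = trans (avail-⊕ˡ a' b i)
    (trans (avail-embed d i) (sym (cong₂ _∨_ (avail-⊕ˡ a b _) (adj-⊕ˡˡ a b v _))))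
  ... | inʳ j rewrite embed-↑ʳ j = trans (avail-⊕ʳ a' b j)
    (sym (trans (cong₂ _∨_ (avail-⊕ʳ a b j) (adj-⊕ˡʳ a b v j)) (∨-identityʳ _)))

deletion-⊕ʳ : {b : Board n} {v : Fin n} {b' : Board o} → Deletion b v b' → (a : Board m) →
              Deletion (a ⊕ b) (m ↑ʳ v) (a ⊕ b')
deletion-⊕ʳ {b = b} {v} {b'} d a =
  subst (λ x → Deletion (a ⊕ b) x (a ⊕ b')) (glue-↑ˡ (⊕-comm-union b a) v)
    (deletion-≅ʳ (deletion-≅ˡ (⊕-comm b a) (deletion-⊕ˡ d a)) (⊕-comm b' a))

-- The mirror strategy

p-[p-q]≡q : ∀ p q → p - (p - q) ≡ q
p-[p-q]≡q = solve 2 (λ p q → p :- (p :- q) := q) refl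
  where open +-*-Solver

p-q-antimonoʳ-≤ : ∀ p {q r} → q ≤ r → p - r ≤ p - q
p-q-antimonoʳ-≤ p q≤r = +-monoʳ-≤ p (neg-antimono-≤ q≤r)

p-q≤r⇒p-r≤q : ∀ p {q r} → p - q ≤ r → p - r ≤ q
p-q≤r⇒p-r≤q p {q} p-q≤r = ≤-trans (p-q-antimonoʳ-≤ p p-q≤r) (≤-reflexive (p-[p-q]≡q p q))

data Even : ℕ → Set
data Odd  : ℕ → Set

data Even where
  even-zero : Even zero
  even-suc  : Odd n → Even (suc n)

data Odd where
  odd-suc : Even n → Odd (suc n)

parity : ∀ n → Even n ⊎ Odd n
parity zero    = inj₁ even-zero
parity (suc n) = [ inj₂ ∘ odd-suc , inj₁ ∘ even-suc ]′ (parity n)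

even-+-even : Even m → Even n → Even (m + n)
even-+-even even-zero                e = e
even-+-even (even-suc (odd-suc e′)) e = even-suc (odd-suc (even-+-even e′ e))

even-+-odd : Even m → Odd n → Odd (m + n)
even-+-odd even-zero                o = o
even-+-odd (even-suc (odd-suc e′)) o = odd-suc (even-suc (even-+-odd e′ o))

even-double : ∀ n → Even (n + n)
even-double zero    = even-zero
even-double (suc n) = even-suc (subst Odd (sym (ℕ.+-suc n n)) (odd-suc (even-double n)))

mirror-even : {x x' : Board m} → x ≅ x' → (k : Board n) → Even n → val ((x ⊕ x') ⊕ k) ≤ val k
mirror-odd  : {x x' : Board m} → x ≅ x' → (k : Board n) → Odd n  → val k ≤ val ((x ⊕ x') ⊕ k)
reply-to-x  : {x x' : Board m} → x ≅ x' → (k : Board n) → Even n → ∀ i → let v = (i ↑ˡ m) ↑ˡ n in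
              legal ((x ⊕ x') ⊕ k) v ≡ true → MoveAtMost ((x ⊕ x') ⊕ k) v (val k)
reply-to-x' : {x x' : Board m} → x ≅ x' → (k : Board n) → Even n → ∀ j → let v = (m ↑ʳ j) ↑ˡ n in
              legal ((x ⊕ x') ⊕ k) v ≡ true → MoveAtMost ((x ⊕ x') ⊕ k) v (val k)
reply-to-k  : {x x' : Board m} → x ≅ x' → (k : Board n) → Even n → ∀ u → let v = (m + m) ↑ʳ u in
              legal ((x ⊕ x') ⊕ k) v ≡ true → MoveAtMost ((x ⊕ x') ⊕ k) v (val k)

mirror-even {m} {n} {x} {x'} I k e = val≤⁺ ((x ⊕ x') ⊕ k) (val k) no-moves reply
  where
  no-moves : (m + m) + n ≡ 0 → 0ℚ ≤ val k
  no-moves size≡0 = ≤-reflexive (sym (val-empty k (ℕ.m+n≡0⇒n≡0 (m + m) size≡0)))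

  reply : ∀ v → legal ((x ⊕ x') ⊕ k) v ≡ true → MoveAtMost ((x ⊕ x') ⊕ k) v (val k)
  reply v with split (m + m) v
  ... | inʳ u = reply-to-k I k e u
  ... | inˡ y with split m y
  ...   | inˡ i = reply-to-x I k e i
  ...   | inʳ j = reply-to-x' I k e j

mirror-odd {m} {suc _} {x} {x'} I k (odd-suc e) with val-attained k
... | u , u-legal , val≡move = begin
  val k                                ≡⟨ val≡move ⟩
  wt k u - val (delete k u)            ≤⟨ p-q-antimonoʳ-≤ (wt k u) (mirror-even I (delete k u) e) ⟩
  wt k u - val ((x ⊕ x') ⊕ delete k u) ≡⟨ cong (_- val ((x ⊕ x') ⊕ delete k u)) (wt-⊕ʳ (x ⊕ x') k u) ⟨
  wt ((x ⊕ x') ⊕ k) ((m + m) ↑ʳ u) - val ((x ⊕ x') ⊕ delete k u)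
    ≤⟨ deletion-move≤val (deletion-⊕ʳ (delete-deletion k u) (x ⊕ x'))
                         (trans (legal-⊕ʳ (x ⊕ x') k u) u-legal) ⟩
  val ((x ⊕ x') ⊕ k)                   ∎
  where open ≤-Reasoning

reply-to-k {m} {suc _} {x} {x'} I k (even-suc o) u u-legal =
  _ , (x ⊕ x') ⊕ delete k u , deletion-⊕ʳ (delete-deletion k u) (x ⊕ x') , bound
  where
  bound : wt ((x ⊕ x') ⊕ k) ((m + m) ↑ʳ u) - val ((x ⊕ x') ⊕ delete k u) ≤ val k
  bound = begin
    wt ((x ⊕ x') ⊕ k) ((m + m) ↑ʳ u) - val ((x ⊕ x') ⊕ delete k u)
      ≡⟨ cong (_- val ((x ⊕ x') ⊕ delete k u)) (wt-⊕ʳ (x ⊕ x') k u) ⟩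
    wt k u - val ((x ⊕ x') ⊕ delete k u) ≤⟨ p-q-antimonoʳ-≤ (wt k u) (mirror-odd I (delete k u) o) ⟩
    wt k u - val (delete k u)            ≤⟨ move≤val k (trans (sym (legal-⊕ʳ (x ⊕ x') k u)) u-legal) ⟩
    val k                                ∎
    where open ≤-Reasoning

reply-to-x {suc m} {n} {x} {x'} I k e i i-legal = _ , after-move , the-move , bound
  where
  wᵢ : ℚ
  wᵢ = wt ((x ⊕ x') ⊕ k) ((i ↑ˡ suc m) ↑ˡ n)

  after-move : Board ((m + suc m) + n)
  after-move = (delete x i ⊕ x') ⊕ k

  after-reply : Board ((m + m) + n)
  after-reply = (delete x i ⊕ delete x' (to I i)) ⊕ k

  the-move : Deletion ((x ⊕ x') ⊕ k) ((i ↑ˡ suc m) ↑ˡ n) after-move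
  the-move = deletion-⊕ˡ (deletion-⊕ˡ (delete-deletion x i) x') k

  mirror-image : Fin ((m + suc m) + n)
  mirror-image = (m ↑ʳ to I i) ↑ˡ n

  the-reply : Deletion after-move mirror-image after-reply
  the-reply = deletion-⊕ˡ (deletion-⊕ʳ (delete-deletion x' (to I i)) (delete x i)) k

  wt-mirror : wt after-move mirror-image ≡ wᵢ
  wt-mirror = begin
    wt after-move mirror-image              ≡⟨ wt-⊕ˡ (delete x i ⊕ x') k _ ⟩
    wt (delete x i ⊕ x') (m ↑ʳ to I i)      ≡⟨ wt-⊕ʳ (delete x i) x' (to I i) ⟩
    wt x' (to I i)                          ≡⟨ wt-to I i ⟩
    wt x i                                  ≡⟨ wt-⊕ˡ x x' i ⟨
    wt (x ⊕ x') (i ↑ˡ suc m)                ≡⟨ wt-⊕ˡ (x ⊕ x') k (i ↑ˡ suc m) ⟨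
    wt ((x ⊕ x') ⊕ k) ((i ↑ˡ suc m) ↑ˡ n)   ∎
    where open ≡-Reasoning

  mirror-legal : legal after-move mirror-image ≡ true
  mirror-legal = begin
    legal after-move mirror-image            ≡⟨ legal-⊕ˡ (delete x i ⊕ x') k _ ⟩
    legal (delete x i ⊕ x') (m ↑ʳ to I i)    ≡⟨ legal-⊕ʳ (delete x i) x' (to I i) ⟩
    legal x' (to I i)                        ≡⟨ legal-≅ I i ⟩
    legal x i                                ≡⟨ legal-⊕ˡ x x' i ⟨
    legal (x ⊕ x') (i ↑ˡ suc m)              ≡⟨ legal-⊕ˡ (x ⊕ x') k (i ↑ˡ suc m) ⟨
    legal ((x ⊕ x') ⊕ k) ((i ↑ˡ suc m) ↑ˡ n) ≡⟨ i-legal ⟩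
    true                                     ∎
    where open ≡-Reasoning

  reply≤ : wᵢ - val after-reply ≤ val after-move
  reply≤ = subst (λ w → w - val after-reply ≤ val after-move) wt-mirror
                 (deletion-move≤val the-reply mirror-legal)

  bound : wᵢ - val after-move ≤ val k
  bound = begin
    wᵢ - val after-move ≤⟨ p-q≤r⇒p-r≤q wᵢ reply≤ ⟩
    val after-reply     ≤⟨ mirror-even (delete-≅ I i) k e ⟩
    val k               ∎
    where open ≤-Reasoning

reply-to-x' {m} {n} {x} {x'} I k e j j-legal =
  subst (λ v → MoveAtMost ((x ⊕ x') ⊕ k) v (val k)) swapped-image
    (moveAtMost-≅ swap-halves (reply-to-x (≅-sym I) k e j swapped-legal))
  where
  swap-halves : (x' ⊕ x) ⊕ k ≅ (x ⊕ x') ⊕ k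
  swap-halves = ⊕-cong (⊕-comm x' x) (≅-refl k)

  swapped-image : to swap-halves ((j ↑ˡ m) ↑ˡ n) ≡ (m ↑ʳ j) ↑ˡ n
  swapped-image = trans (glue-↑ˡ (⊕-cong-union (⊕-comm x' x) (≅-refl k)) (j ↑ˡ m))
                        (cong (_↑ˡ n) (glue-↑ˡ (⊕-comm-union x' x) j))

  swapped-legal : legal ((x' ⊕ x) ⊕ k) ((j ↑ˡ m) ↑ˡ n) ≡ true
  swapped-legal = trans (sym (legal-≅ swap-halves _))
                        (trans (cong (legal ((x ⊕ x') ⊕ k)) swapped-image) j-legal)

theorem3p3 : {n : ℕ} (g : Board n) → Invertible g → (g ⊕ g) ∼ empty
theorem3p3 {n} g (_ , h , g⊕h∼empty) p c = [ even-case , odd-case ]′ (parity p)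
  where
  val-c : val c ≡ val ((h ⊕ h) ⊕ ((g ⊕ g) ⊕ c))
  val-c = begin
    val c                          ≡⟨ g⊕h∼empty _ c ⟨
    val ((g ⊕ h) ⊕ c)              ≡⟨ g⊕h∼empty _ ((g ⊕ h) ⊕ c) ⟨
    val ((g ⊕ h) ⊕ ((g ⊕ h) ⊕ c))  ≡⟨ val-≅ (⊕-pair-up g h c) ⟩
    val ((h ⊕ h) ⊕ ((g ⊕ g) ⊕ c))  ∎
    where open ≡-Reasoning

  even-case : Even p → val ((g ⊕ g) ⊕ c) ≡ val c
  even-case p-even = ≤-antisym (mirror-even (≅-refl g) c p-even)
    (subst (_≤ val ((g ⊕ g) ⊕ c)) (sym val-c)
      (mirror-even (≅-refl h) ((g ⊕ g) ⊕ c) (even-+-even (even-double n) p-even)))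

  odd-case : Odd p → val ((g ⊕ g) ⊕ c) ≡ val c
  odd-case p-odd = ≤-antisym
    (subst (val ((g ⊕ g) ⊕ c) ≤_) (sym val-c)
      (mirror-odd (≅-refl h) ((g ⊕ g) ⊕ c) (even-+-odd (even-double n) p-odd)))
    (mirror-odd (≅-refl g) c p-odd)
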